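{- The following data reduction rule for \textsc{Strong Triadic Closure} is safe (i.e., it transforms an instance into an equivalent instance): given an instance $(G,k)$, if $G$ has a closed critical clique $K$ with $|K|>|E_G(\mathcal{N}(K),\mathcal{N}^2(K))|$, then remove all vertices of $K$ and of $\mathcal{N}(K)$ from $G$ and decrease $k$ by $|E_G(\mathcal{N}(K),\mathcal{N}^2(K))|$.
   Context: All graphs are finite, undirected and simple. A labeling $L=(S_L,W_L)$ of $G=(V,E)$ is a partition of $E$ into strong edges $S_L$ and weak edges $W_L$; it is an STC-labeling if there are no strong edges $\{u,v\},\{v,w\}\in S_L$ with $\{u,w\}\notin E$. \textsc{Strong Triadic Closure}: given a graph $G=(V,E)$ and $k\in\mathbb{N}$, decide whether $G$ has an STC-labeling with $|W_L|\le k$. For $V_1,V_2\subseteq V$, $E_G(V_1,V_2)$ is the set of edges with one endpoint in $V_1$ and the other in $V_2$. A critical clique of $G$ is a clique $K$ whose vertices all have the same neighbors in $V\setminus K$, inclusion-maximal with this property. The critical clique graph $\mathcal{C}$ has the critical cliques as vertices, two being adjacent iff all vertices of one are adjacent to all vertices of the other. $\mathcal{N}(K)$ is the union of the critical cliques adjacent to $K$ in $\mathcal{C}$, and $\mathcal{N}^2(K)$ is the union of the critical cliques at distance exactly two from $K$ in $\mathcal{C}$. $K$ is closed if $\mathcal{N}(K)$ is a clique in $G$. -}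

module Defs where

open import Data.Nat using (ℕ; zero; suc; _+_)
open import Data.Integer as ℤ using (ℤ)
open import Data.Bool using (Bool; true; false; T; _∧_; _∨_; not; if_then_else_)
open import Data.Fin using (Fin; _<?_)
open import Data.List using (List; map; allFin; concatMap)
open import Data.Nat.ListAction using (sum)
open import Data.Product using (Σ; ∃; _×_; _,_)
open import Relation.Nullary using (¬_; does)
open import Relation.Binary.PropositionalEquality using (_≡_; _≢_)

record Graph (n : ℕ) : Set where
  field
    adj    : Fin n → Fin n → Bool
    sym    : ∀ u v → adj u v ≡ adj v u
    irrefl : ∀ v → adj v v ≡ false
open Graph public

VSet : ℕ → Set
VSet n = Fin n → Bool

_∈_ : ∀ {n} → Fin n → VSet n → Set
v ∈ A = T (A v)

_∉_ : ∀ {n} → Fin n → VSet n → Set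
v ∉ A = ¬ (v ∈ A)

_⊆_ : ∀ {n} → VSet n → VSet n → Set
A ⊆ B = ∀ v → v ∈ A → v ∈ B

∣_∣ : ∀ {n} → VSet n → ℕ
∣ A ∣ = sum (map (λ v → if A v then 1 else 0) (allFin _))

-- Number of unordered pairs {i,j} (i ≠ j) satisfying p (p is
-- evaluated with the smaller index first).
countPairs : ∀ {n} → (Fin n → Fin n → Bool) → ℕ
countPairs {n} p =
  sum (concatMap (λ i → map (λ j → if does (i <? j) ∧ p i j then 1 else 0) (allFin n)) (allFin n))

edgesBetween : ∀ {n} → Graph n → VSet n → VSet n → ℕ
edgesBetween G A B =
  countPairs (λ u v → adj G u v ∧ ((A u ∧ B v) ∨ (B u ∧ A v)))

IsClique : ∀ {n} → Graph n → VSet n → Set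
IsClique G A = ∀ u v → u ∈ A → v ∈ A → u ≢ v → T (adj G u v)

SameNbhdClique : ∀ {n} → Graph n → VSet n → Set
SameNbhdClique G A =
  IsClique G A × (∀ u v w → u ∈ A → v ∈ A → w ∉ A → adj G u w ≡ adj G v w)

CriticalClique : ∀ {n} → Graph n → VSet n → Set
CriticalClique G K =
  SameNbhdClique G K × (∀ K′ → K ⊆ K′ → SameNbhdClique G K′ → K′ ⊆ K)

_≐_ : ∀ {n} → VSet n → VSet n → Set
A ≐ B = ∀ v → A v ≡ B v

-- Adjacency in the critical clique graph 𝒞: every vertex of one is
-- adjacent to every vertex of the other.
CAdj : ∀ {n} → Graph n → VSet n → VSet n → Set
CAdj G K₁ K₂ = ∀ u v → u ∈ K₁ → v ∈ K₂ → T (adj G u v)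

In𝒩 : ∀ {n} → Graph n → VSet n → Fin n → Set
In𝒩 G K v = ∃ λ K′ → CriticalClique G K′ × CAdj G K K′ × v ∈ K′

-- v ∈ 𝒩²(K): v lies in a critical clique at distance exactly two from K
-- in 𝒞 (distinct from K, not adjacent to K, with a common neighbour).
In𝒩² : ∀ {n} → Graph n → VSet n → Fin n → Set
In𝒩² G K v = ∃ λ K″ → CriticalClique G K″ × v ∈ K″ × ¬ (K ≐ K″) × ¬ CAdj G K K″
  × (∃ λ K′ → CriticalClique G K′ × CAdj G K K′ × CAdj G K′ K″)

-- An STC-labeling of the induced subgraph G[S] with at most k weak edges
-- (k an integer budget, so that a negative budget is unsatisfiable).
-- The labeling is given by its strong edge set (symmetric, a subset of E(G[S]));
-- weak edges are the remaining edges of G[S].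
STCSolvable : ∀ {n} → Graph n → VSet n → ℤ → Set
STCSolvable {n} G S k = Σ (Fin n → Fin n → Bool) λ strong →
    (∀ u v → strong u v ≡ strong v u)
  × (∀ u v → T (strong u v) → T (adj G u v) × u ∈ S × v ∈ S)
  × (∀ u v w → u ≢ w → T (strong u v) → T (strong v w) → T (adj G u w))
  × (ℤ.+ countPairs (λ u v → S u ∧ S v ∧ adj G u v ∧ not (strong u v)) ℤ.≤ k)

allV : ∀ {n} → VSet n
allV _ = true

-- Let X = K ∪ 𝒩(K). As K is closed, X is a clique, and every edge leaving X joins 𝒩(K) to 𝒩²(K):
-- the critical clique of its outer endpoint is adjacent in 𝒞 to a critical clique of 𝒩(K) but is
-- neither K nor adjacent to K. Hence an STC-labeling of G − X extends to G by making every edge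
-- inside X strong, at the cost of at most |E(𝒩(K),𝒩²(K))| further weak edges. Conversely,
-- restricting an STC-labeling of G to G − X saves at least that many weak edges: either all edges
-- between 𝒩(K) and 𝒩²(K) are weak, or one of them, vw, is strong, and then every edge uv with
-- u ∈ K is weak because u and w are non-adjacent; that gives |K| weak edges.

module Submission where

open import Defs
open import Data.Nat using (ℕ; _>_)
open import Data.Integer using (+_; _-_)
open import Data.Bool using (Bool; not; _∨_)
open import Data.Fin using (Fin)
open import Function.Bundles using (_⇔_)

open import Algebra.Bundles using (AbelianGroup; CommutativeMonoid)
open import Data.Bool using (true; false; T; _∧_; if_then_else_)
open import Data.Bool.Properties as Bool using (T-≡; T-∧; T-∨; ∧-commutativeMonoid)
open import Data.Empty using (⊥; ⊥-elim)
open import Data.Fin using (zero; suc; _<?_)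
open import Data.Fin.Properties using (_≟_; <-cmp; all?; any?)
open import Data.Integer as ℤ using (ℤ; -_; +≤+)
open import Data.Integer.Properties as ℤ using (+-0-abelianGroup; pos-+)
open import Data.List using (List; []; _∷_; map; allFin; concatMap; tabulate)
open import Data.List.Properties using (map-tabulate)
open import Data.Nat using (zero; suc; _+_; _≤_; z≤n; s≤s)
open import Data.Nat.ListAction using (sum)
open import Data.Nat.ListAction.Properties using (sum-++)
open import Data.Nat.Properties
  using (≤-trans; ≤-reflexive; <⇒≤; +-mono-≤; +-monoʳ-≤; m≤m+n; m≤n+m; +-0-commutativeMonoid; module ≤-Reasoning)
open import Data.Product using (_×_; _,_; proj₁; proj₂; swap)
open import Data.Sum as Sum using (_⊎_; inj₁; inj₂)
open import Data.Unit using (tt)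
open import Function using (_∘_; id)
open import Function.Bundles using (mk⇔; Equivalence; module Equivalence)
open import Relation.Binary.Definitions using (tri<; tri≈; tri>)
open import Relation.Binary.PropositionalEquality as ≡ using (_≡_; _≢_; refl; trans; cong; cong₂; subst)
open import Relation.Nullary using (¬_; Dec; does; yes; no; _because_; ofʸ; ofⁿ)
open import Relation.Nullary.Decidable using (T?; _×-dec_; dec-true; dec-false)
open import Algebra.Properties.CommutativeMonoid.Sum +-0-commutativeMonoid
  using (sum-syntax; sum-cong-≗; ∑-distrib-+) renaming (sum to ∑)
open import Algebra.Properties.CommutativeSemigroup (CommutativeMonoid.commutativeSemigroup ∧-commutativeMonoid)
  using () renaming (x∙yz≈y∙xz to ∧-swapˡ)
open import Algebra.Properties.Group (AbelianGroup.group +-0-abelianGroup)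
  using (//-rightDividesˡ; //-rightDividesʳ)

open Equivalence using (to; from)

T-does : ∀ {A : Set} (a? : Dec A) → T (does a?) ⇔ A
T-does (true because ofʸ a) = mk⇔ (λ _ → a) _
T-does (false because ofⁿ ¬a) = mk⇔ (λ ()) ¬a

T-not : ∀ {x} → T (not x) ⇔ (¬ T x)
T-not {false} = mk⇔ (λ _ ()) _
T-not {true} = mk⇔ (λ ()) (λ ¬⊤ → ¬⊤ tt)

T-injective : ∀ {x y} → (T x → T y) → (T y → T x) → x ≡ y
T-injective {false} {false} _ _ = refl
T-injective {false} {true} _ y⇒x = ⊥-elim (y⇒x tt)
T-injective {true} {false} x⇒y _ = ⊥-elim (x⇒y tt)
T-injective {true} {true} _ _ = refl

∧-intro : ∀ {x y} → T x → T y → T (x ∧ y)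
∧-intro a b = from T-∧ (a , b)

∧-monoʳ : ∀ c {x y} → (T x → T y) → T (c ∧ x) → T (c ∧ y)
∧-monoʳ true x⇒y = x⇒y

𝟙 : Bool → ℕ
𝟙 b = if b then 1 else 0

𝟙-mono-≤ : ∀ {x y} → (T x → T y) → 𝟙 x ≤ 𝟙 y
𝟙-mono-≤ {false} _ = z≤n
𝟙-mono-≤ {true} {true} _ = s≤s z≤n
𝟙-mono-≤ {true} {false} x⇒y = ⊥-elim (x⇒y tt)

𝟙-≤-+ : ∀ {x y z} → (T z → T x ⊎ T y) → 𝟙 z ≤ 𝟙 x + 𝟙 y
𝟙-≤-+ {z = false} _ = z≤n
𝟙-≤-+ {true} {z = true} _ = s≤s z≤n
𝟙-≤-+ {false} {true} {true} _ = s≤s z≤n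
𝟙-≤-+ {false} {false} {true} z⇒x∨y with z⇒x∨y tt
... | inj₁ ()
... | inj₂ ()

𝟙-+-≤ : ∀ {x y z} → (T x → T z) → (T y → T z) → (T x → T y → ⊥) → 𝟙 x + 𝟙 y ≤ 𝟙 z
𝟙-+-≤ {false} {false} _ _ _ = z≤n
𝟙-+-≤ {true} {false} x⇒z _ _ = 𝟙-mono-≤ x⇒z
𝟙-+-≤ {false} {true} _ y⇒z _ = 𝟙-mono-≤ y⇒z
𝟙-+-≤ {true} {true} _ _ x∩y=∅ = ⊥-elim (x∩y=∅ tt tt)

sum-tabulate : ∀ {n} (f : Fin n → ℕ) → sum (tabulate f) ≡ ∑[ i < n ] f i
sum-tabulate {zero} f = refl
sum-tabulate {suc n} f = cong (λ s → f zero + s) (sum-tabulate (f ∘ suc))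

sum-map-allFin : ∀ {n} (f : Fin n → ℕ) → sum (map f (allFin n)) ≡ ∑[ i < n ] f i
sum-map-allFin f = trans (cong sum (map-tabulate id f)) (sum-tabulate f)

sum-concatMap : ∀ {A : Set} (g : A → List ℕ) xs → sum (concatMap g xs) ≡ sum (map (sum ∘ g) xs)
sum-concatMap g [] = refl
sum-concatMap g (x ∷ xs) =
  trans (sum-++ (g x) (concatMap g xs)) (cong (λ s → sum (g x) + s) (sum-concatMap g xs))

∑-term-≤ : ∀ {n} (f : Fin n → ℕ) i → f i ≤ ∑[ j < n ] f j
∑-term-≤ f zero = m≤m+n _ _
∑-term-≤ f (suc i) = ≤-trans (∑-term-≤ (f ∘ suc) i) (m≤n+m _ (f zero))

∑-mono-≤ : ∀ {n} {f g : Fin n → ℕ} → (∀ i → f i ≤ g i) → ∑[ i < n ] f i ≤ ∑[ i < n ] g i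
∑-mono-≤ {zero} _ = z≤n
∑-mono-≤ {suc n} f≤g = +-mono-≤ (f≤g zero) (∑-mono-≤ (f≤g ∘ suc))

∑-+-≤ : ∀ {n} {f g h : Fin n → ℕ} → (∀ i → f i + g i ≤ h i) →
  ∑[ i < n ] f i + ∑[ i < n ] g i ≤ ∑[ i < n ] h i
∑-+-≤ {f = f} {g} f+g≤h = ≤-trans (≤-reflexive (≡.sym (∑-distrib-+ f g))) (∑-mono-≤ f+g≤h)

∑-≤-+ : ∀ {n} {f g h : Fin n → ℕ} → (∀ i → h i ≤ f i + g i) →
  ∑[ i < n ] h i ≤ ∑[ i < n ] f i + ∑[ i < n ] g i
∑-≤-+ {f = f} {g} h≤f+g = ≤-trans (∑-mono-≤ h≤f+g) (≤-reflexive (∑-distrib-+ f g))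

∣∣≡∑ : ∀ {n} (A : VSet n) → ∣ A ∣ ≡ ∑[ i < n ] 𝟙 (A i)
∣∣≡∑ A = sum-map-allFin (𝟙 ∘ A)

countPairs≡∑∑ : ∀ {n} (p : Fin n → Fin n → Bool) →
  countPairs p ≡ ∑[ i < n ] ∑[ j < n ] 𝟙 (does (i <? j) ∧ p i j)
countPairs≡∑∑ {n} p = begin
  countPairs p                         ≡⟨ sum-concatMap row (allFin n) ⟩
  sum (map (sum ∘ row) (allFin n))     ≡⟨ sum-map-allFin (sum ∘ row) ⟩
  ∑[ i < n ] sum (row i)               ≡⟨ sum-cong-≗ {n} (λ i → sum-map-allFin (entry i)) ⟩
  ∑[ i < n ] ∑[ j < n ] 𝟙 (does (i <? j) ∧ p i j) ∎
  where
  open ≡.≡-Reasoning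
  entry : Fin n → Fin n → ℕ
  entry i j = 𝟙 (does (i <? j) ∧ p i j)
  row : Fin n → List ℕ
  row i = map (entry i) (allFin n)

countPairs-mono-≤ : ∀ {n} (p q : Fin n → Fin n → Bool) →
  (∀ i j → T (p i j) → T (q i j)) → countPairs p ≤ countPairs q
countPairs-mono-≤ {n} p q p⊆q rewrite countPairs≡∑∑ p | countPairs≡∑∑ q =
  ∑-mono-≤ {n} λ i → ∑-mono-≤ {n} λ j → 𝟙-mono-≤ (∧-monoʳ (does (i <? j)) (p⊆q i j))

countPairs-≤-+ : ∀ {n} (p q r : Fin n → Fin n → Bool) →
  (∀ i j → T (r i j) → T (p i j) ⊎ T (q i j)) → countPairs r ≤ countPairs p + countPairs q
countPairs-≤-+ p q r r⊆p∪q rewrite countPairs≡∑∑ p | countPairs≡∑∑ q | countPairs≡∑∑ r =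
  ∑-≤-+ λ i → ∑-≤-+ λ j → guarded (does (i <? j)) (r⊆p∪q i j)
  where
  guarded : ∀ c {x y z} → (T z → T x ⊎ T y) → 𝟙 (c ∧ z) ≤ 𝟙 (c ∧ x) + 𝟙 (c ∧ y)
  guarded false _ = z≤n
  guarded true = 𝟙-≤-+

countPairs-+-≤ : ∀ {n} (p q r : Fin n → Fin n → Bool) →
  (∀ i j → T (p i j) → T (r i j)) → (∀ i j → T (q i j) → T (r i j)) →
  (∀ i j → T (p i j) → T (q i j) → ⊥) → countPairs p + countPairs q ≤ countPairs r
countPairs-+-≤ p q r p⊆r q⊆r p∩q=∅
  rewrite countPairs≡∑∑ p | countPairs≡∑∑ q | countPairs≡∑∑ r =
  ∑-+-≤ λ i → ∑-+-≤ λ j → guarded (does (i <? j)) (p⊆r i j) (q⊆r i j) (p∩q=∅ i j)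
  where
  guarded : ∀ c {x y z} → (T x → T z) → (T y → T z) → (T x → T y → ⊥) →
    𝟙 (c ∧ x) + 𝟙 (c ∧ y) ≤ 𝟙 (c ∧ z)
  guarded false _ _ _ = z≤n
  guarded true = 𝟙-+-≤

｛_｝ : ∀ {n} → Fin n → VSet n
｛ v ｝ u = does (u ≟ v)

∁ : ∀ {n} → VSet n → VSet n
∁ A v = not (A v)

Disjoint : ∀ {n} → VSet n → VSet n → Set
Disjoint A B = ∀ x → x ∈ A → x ∈ B → ⊥

crossing : ∀ {n} → VSet n → VSet n → Fin n → Fin n → Bool
crossing A B u v = (A u ∧ B v) ∨ (B u ∧ A v)

crossing⁻ : ∀ {n} (A B : VSet n) u v → T (crossing A B u v) → (u ∈ A × v ∈ B) ⊎ (u ∈ B × v ∈ A)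
crossing⁻ A B u v = Sum.map (to (T-∧ {A u})) (to (T-∧ {B u})) ∘ to (T-∨ {A u ∧ B v})

crossing⁺ : ∀ {n} (A B : VSet n) u v → (u ∈ A × v ∈ B) ⊎ (u ∈ B × v ∈ A) → T (crossing A B u v)
crossing⁺ A B u v = from (T-∨ {A u ∧ B v}) ∘ Sum.map (from T-∧) (from T-∧)

-- The pair {i, v} is counted in column v when i < v and in row v when v < i.
∣∣≤countPairs-crossing-｛｝ : ∀ {n} (A : VSet n) v → v ∉ A →
  ∣ A ∣ ≤ countPairs (crossing A ｛ v ｝)
∣∣≤countPairs-crossing-｛｝ {n} A v v∉A = begin
  ∣ A ∣                                      ≡⟨ ∣∣≡∑ A ⟩
  ∑[ i < n ] 𝟙 (A i)                         ≤⟨ ∑-≤-+ (λ i → 𝟙-≤-+ (below-or-above i)) ⟩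
  ∑[ i < n ] 𝟙 (does (i <? v) ∧ A i)
    + ∑[ j < n ] 𝟙 (does (v <? j) ∧ A j)     ≤⟨ +-mono-≤ column row ⟩
  countPairs (λ i j → A i ∧ ｛ v ｝ j)
    + countPairs (λ i j → ｛ v ｝ i ∧ A j)   ≤⟨ countPairs-+-≤ _ _ _ (λ _ _ → from T-∨ ∘ inj₁)
                                                              (λ _ _ → from T-∨ ∘ inj₂) disjoint ⟩
  countPairs (crossing A ｛ v ｝)           ∎
  where
  open ≤-Reasoning
  v∈｛v｝ : v ∈ ｛ v ｝
  v∈｛v｝ = from (T-does (v ≟ v)) refl
  below-or-above : ∀ i → i ∈ A → T (does (i <? v) ∧ A i) ⊎ T (does (v <? i) ∧ A i)
  below-or-above i i∈A with <-cmp i v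
  ... | tri< i<v _ _ = inj₁ (∧-intro (from (T-does (i <? v)) i<v) i∈A)
  ... | tri≈ _ refl _ = ⊥-elim (v∉A i∈A)
  ... | tri> _ _ v<i = inj₂ (∧-intro (from (T-does (v <? i)) v<i) i∈A)
  column : ∑[ i < n ] 𝟙 (does (i <? v) ∧ A i) ≤ countPairs (λ i j → A i ∧ ｛ v ｝ j)
  column rewrite countPairs≡∑∑ (λ i j → A i ∧ ｛ v ｝ j) = ∑-mono-≤ {n} λ i →
    ≤-trans (𝟙-mono-≤ (∧-monoʳ (does (i <? v)) (λ i∈A → ∧-intro i∈A v∈｛v｝)))
            (∑-term-≤ _ v)
  row : ∑[ j < n ] 𝟙 (does (v <? j) ∧ A j) ≤ countPairs (λ i j → ｛ v ｝ i ∧ A j)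
  row rewrite countPairs≡∑∑ (λ i j → ｛ v ｝ i ∧ A j) =
    ≤-trans (∑-mono-≤ {n} λ j → 𝟙-mono-≤ (∧-monoʳ (does (v <? j)) (∧-intro v∈｛v｝)))
            (∑-term-≤ _ v)
  disjoint : ∀ i j → T (A i ∧ ｛ v ｝ j) → T (｛ v ｝ i ∧ A j) → ⊥
  disjoint i j i-v v-j with to (T-∧ {A i}) i-v | to (T-∧ {｛ v ｝ i}) v-j
  ... | i∈A , _ | i≡v , _ = v∉A (subst (_∈ A) (to (T-does (i ≟ v)) i≡v) i∈A)

-- Critical cliques are the classes of closed twins

module _ {n} (G : Graph n) where

  N[_] : Fin n → VSet n
  N[ v ] x = does (v ≟ x) ∨ adj G v x

  N[]-self : ∀ v → N[ v ] v ≡ true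
  N[]-self v = cong (_∨ adj G v v) (dec-true (v ≟ v) refl)

  N[]-≢ : ∀ {v x} → v ≢ x → N[ v ] x ≡ adj G v x
  N[]-≢ {v} {x} v≢x = cong (_∨ adj G v x) (dec-false (v ≟ x) v≢x)

  N[]-clique : ∀ {A v x} → IsClique G A → v ∈ A → x ∈ A → N[ v ] x ≡ true
  N[]-clique {v = v} {x} A-clique v∈A x∈A with v ≟ x
  ... | yes _ = refl
  ... | no v≢x = to T-≡ (A-clique v x v∈A x∈A v≢x)

  twins : Fin n → VSet n
  twins v w = does (all? λ x → N[ v ] x Bool.≟ N[ w ] x)

  twins⇔ : ∀ {v w} → w ∈ twins v ⇔ (∀ x → N[ v ] x ≡ N[ w ] x)
  twins⇔ = T-does (all? _)

  twins-refl : ∀ v → v ∈ twins v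
  twins-refl v = from twins⇔ λ _ → refl

  twins-sameNbhdClique : ∀ v → SameNbhdClique G (twins v)
  twins-sameNbhdClique v = clique , sameNbhd
    where
    open ≡.≡-Reasoning
    clique : IsClique G (twins v)
    clique u w u∈ w∈ u≢w = from T-≡ (begin
      adj G u w  ≡⟨ ≡.sym (N[]-≢ u≢w) ⟩
      N[ u ] w   ≡⟨ ≡.sym (to twins⇔ u∈ w) ⟩
      N[ v ] w   ≡⟨ to twins⇔ w∈ w ⟩
      N[ w ] w   ≡⟨ N[]-self w ⟩
      true       ∎)
    sameNbhd : ∀ u w x → u ∈ twins v → w ∈ twins v → x ∉ twins v → adj G u x ≡ adj G w x
    sameNbhd u w x u∈ w∈ x∉ = begin
      adj G u x  ≡⟨ ≡.sym (N[]-≢ λ { refl → x∉ u∈ }) ⟩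
      N[ u ] x   ≡⟨ ≡.sym (to twins⇔ u∈ x) ⟩
      N[ v ] x   ≡⟨ to twins⇔ w∈ x ⟩
      N[ w ] x   ≡⟨ N[]-≢ (λ { refl → x∉ w∈ }) ⟩
      adj G w x  ∎

  sameNbhdClique⊆twins : ∀ {A v} → SameNbhdClique G A → v ∈ A → A ⊆ twins v
  sameNbhdClique⊆twins {A} {v} (A-clique , A-sameNbhd) v∈A w w∈A = from twins⇔ N[v]≗N[w]
    where
    N[v]≗N[w] : ∀ x → N[ v ] x ≡ N[ w ] x
    N[v]≗N[w] x with T? (A x)
    ... | yes x∈A = trans (N[]-clique A-clique v∈A x∈A) (≡.sym (N[]-clique A-clique w∈A x∈A))
    ... | no x∉A = trans (N[]-≢ λ { refl → x∉A v∈A })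
                     (trans (A-sameNbhd v w x v∈A w∈A x∉A) (≡.sym (N[]-≢ λ { refl → x∉A w∈A })))

  twins-critical : ∀ v → CriticalClique G (twins v)
  twins-critical v = twins-sameNbhdClique v ,
    λ K′ twins⊆K′ K′-sameNbhd → sameNbhdClique⊆twins K′-sameNbhd (twins⊆K′ v (twins-refl v))

  critical≐twins : ∀ {K v} → CriticalClique G K → v ∈ K → K ≐ twins v
  critical≐twins {K} {v} (K-sameNbhd , K-maximal) v∈K x =
    T-injective (K⊆twins x) (K-maximal (twins v) K⊆twins (twins-sameNbhdClique v) x)
    where
    K⊆twins : K ⊆ twins v
    K⊆twins = sameNbhdClique⊆twins K-sameNbhd v∈K

  critical-≐ : ∀ {K₁ K₂ x} → CriticalClique G K₁ → CriticalClique G K₂ →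
    x ∈ K₁ → x ∈ K₂ → K₁ ≐ K₂
  critical-≐ K₁-critical K₂-critical x∈K₁ x∈K₂ y =
    trans (critical≐twins K₁-critical x∈K₁ y) (≡.sym (critical≐twins K₂-critical x∈K₂ y))

  sameNbhdCliques-CAdj : ∀ {K₁ K₂ u w} →
    SameNbhdClique G K₁ → SameNbhdClique G K₂ → Disjoint K₁ K₂ →
    u ∈ K₁ → w ∈ K₂ → T (adj G u w) → CAdj G K₁ K₂
  sameNbhdCliques-CAdj {u = u} {w} (_ , K₁-sameNbhd) (_ , K₂-sameNbhd) K₁∩K₂=∅ u∈K₁ w∈K₂ uw
    x y x∈K₁ y∈K₂ =
    subst T (≡.sym (begin
      adj G x y  ≡⟨ K₁-sameNbhd x u y x∈K₁ u∈K₁ (λ y∈K₁ → K₁∩K₂=∅ y y∈K₁ y∈K₂) ⟩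
      adj G u y  ≡⟨ sym G u y ⟩
      adj G y u  ≡⟨ K₂-sameNbhd y w u y∈K₂ w∈K₂ (K₁∩K₂=∅ u u∈K₁) ⟩
      adj G w u  ≡⟨ sym G w u ⟩
      adj G u w  ∎)) uw
    where open ≡.≡-Reasoning

-- Restricting and extending STC-labelings

module _ {n} (G : Graph n) where

  IsSTCLabeling : VSet n → (Fin n → Fin n → Bool) → Set
  IsSTCLabeling S s = (∀ u v → s u v ≡ s v u)
    × (∀ u v → T (s u v) → T (adj G u v) × u ∈ S × v ∈ S)
    × (∀ u v w → u ≢ w → T (s u v) → T (s v w) → T (adj G u w))

  weak : VSet n → (Fin n → Fin n → Bool) → Fin n → Fin n → Bool
  weak S s u v = S u ∧ S v ∧ adj G u v ∧ not (s u v)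

  STCSolvable⁺ : ∀ {S k} s → IsSTCLabeling S s → + countPairs (weak S s) ℤ.≤ k → STCSolvable G S k
  STCSolvable⁺ s (s-sym , s-edges , s-closed) budget = s , s-sym , s-edges , s-closed , budget

  restrict : VSet n → (Fin n → Fin n → Bool) → Fin n → Fin n → Bool
  restrict S s u v = S u ∧ S v ∧ s u v

  restrict⁻ : ∀ S s u v → T (restrict S s u v) → u ∈ S × v ∈ S × T (s u v)
  restrict⁻ S s u v t with to (T-∧ {S u}) t
  ... | u∈S , t′ with to (T-∧ {S v}) t′
  ... | v∈S , suv = u∈S , v∈S , suv

  restrict-isSTC : ∀ {S s} → IsSTCLabeling allV s → IsSTCLabeling S (restrict S s)
  restrict-isSTC {S} {s} (s-sym , s-edges , s-closed) = restrict-sym , restrict-edges , restrict-closed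
    where
    restrict-sym : ∀ u v → restrict S s u v ≡ restrict S s v u
    restrict-sym u v = trans (cong (λ b → S u ∧ (S v ∧ b)) (s-sym u v)) (∧-swapˡ (S u) (S v) (s v u))
    restrict-edges : ∀ u v → T (restrict S s u v) → T (adj G u v) × u ∈ S × v ∈ S
    restrict-edges u v t with restrict⁻ S s u v t
    ... | u∈S , v∈S , suv = proj₁ (s-edges u v suv) , u∈S , v∈S
    restrict-closed : ∀ u v w → u ≢ w → T (restrict S s u v) → T (restrict S s v w) → T (adj G u w)
    restrict-closed u v w u≢w suv svw =
      s-closed u v w u≢w (proj₂ (proj₂ (restrict⁻ S s u v suv))) (proj₂ (proj₂ (restrict⁻ S s v w svw)))

  weak-restrict⁻ : ∀ S s u v → T (weak S (restrict S s) u v) → u ∈ S × v ∈ S × T (weak allV s u v)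
  weak-restrict⁻ S s u v t with restrict⁻ S (λ u v → adj G u v ∧ not (restrict S s u v)) u v t
  ... | u∈S , v∈S , t′ with to (T-∧ {adj G u v}) t′
  ... | uv , ¬restricted = u∈S , v∈S ,
    ∧-intro uv (from T-not λ suv → to T-not ¬restricted (∧-intro u∈S (∧-intro v∈S suv)))

  weak-restrict-+-≤ : ∀ S s (q : Fin n → Fin n → Bool) →
    (∀ i j → T (q i j) → T (weak allV s i j)) → (∀ i j → T (q i j) → i ∉ S ⊎ j ∉ S) →
    countPairs (weak S (restrict S s)) + countPairs q ≤ countPairs (weak allV s)
  weak-restrict-+-≤ S s q q⊆weak q-leaves-S =
    countPairs-+-≤ _ _ _ (λ i j t → proj₂ (proj₂ (weak-restrict⁻ S s i j t))) q⊆weak disjoint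
    where
    disjoint : ∀ i j → T (weak S (restrict S s) i j) → T (q i j) → ⊥
    disjoint i j t qij with weak-restrict⁻ S s i j t | q-leaves-S i j qij
    ... | i∈S , _ , _ | inj₁ i∉S = i∉S i∈S
    ... | _ , j∈S , _ | inj₂ j∉S = j∉S j∈S

  extend : VSet n → (Fin n → Fin n → Bool) → Fin n → Fin n → Bool
  extend X s u v = (X u ∧ X v ∧ adj G u v) ∨ s u v

  extend-isSTC : ∀ {X s} → IsClique G X → IsSTCLabeling (∁ X) s → IsSTCLabeling allV (extend X s)
  extend-isSTC {X} {s} X-clique (s-sym , s-edges , s-closed) = extend-sym , extend-edges , extend-closed
    where
    inside⁻ : ∀ {u v} → T (X u ∧ X v ∧ adj G u v) → u ∈ X × v ∈ X × T (adj G u v)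
    inside⁻ {u} {v} = restrict⁻ X (adj G) u v
    extend⁻ : ∀ u v → T (extend X s u v) → T (X u ∧ X v ∧ adj G u v) ⊎ T (s u v)
    extend⁻ u v = to (T-∨ {X u ∧ X v ∧ adj G u v})
    extend-sym : ∀ u v → extend X s u v ≡ extend X s v u
    extend-sym u v = cong₂ _∨_
      (trans (cong (λ b → X u ∧ (X v ∧ b)) (sym G u v)) (∧-swapˡ (X u) (X v) (adj G v u))) (s-sym u v)
    extend-edges : ∀ u v → T (extend X s u v) → T (adj G u v) × u ∈ allV × v ∈ allV
    extend-edges u v t with extend⁻ u v t
    ... | inj₁ inside = proj₂ (proj₂ (inside⁻ inside)) , tt , tt
    ... | inj₂ suv = proj₁ (s-edges u v suv) , tt , tt
    extend-closed : ∀ u v w → u ≢ w → T (extend X s u v) → T (extend X s v w) → T (adj G u w)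
    extend-closed u v w u≢w t₁ t₂ with extend⁻ u v t₁ | extend⁻ v w t₂
    ... | inj₁ uv-inside | inj₁ vw-inside =
      X-clique u w (proj₁ (inside⁻ uv-inside)) (proj₁ (proj₂ (inside⁻ vw-inside))) u≢w
    ... | inj₁ uv-inside | inj₂ svw =
      ⊥-elim (to T-not (proj₁ (proj₂ (s-edges v w svw))) (proj₁ (proj₂ (inside⁻ uv-inside))))
    ... | inj₂ suv | inj₁ vw-inside =
      ⊥-elim (to T-not (proj₂ (proj₂ (s-edges u v suv))) (proj₁ (inside⁻ vw-inside)))
    ... | inj₂ suv | inj₂ svw = s-closed u v w u≢w suv svw

  weak-extend-≤ : ∀ X s →
    countPairs (weak allV (extend X s)) ≤ countPairs (weak (∁ X) s) + edgesBetween G X (∁ X)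
  weak-extend-≤ X s = countPairs-≤-+ _ _ _ cover
    where
    cover : ∀ u v → T (weak allV (extend X s) u v) →
      T (weak (∁ X) s u v) ⊎ T (adj G u v ∧ crossing X (∁ X) u v)
    cover u v t with to (T-∧ {adj G u v}) t | T? (X u) | T? (X v)
    ... | uv , ¬extended | yes u∈X | yes v∈X =
      ⊥-elim (to T-not ¬extended (from T-∨ (inj₁ (∧-intro u∈X (∧-intro v∈X uv)))))
    ... | uv , _ | yes u∈X | no v∉X =
      inj₂ (∧-intro uv (from T-∨ (inj₁ (∧-intro u∈X (from T-not v∉X)))))
    ... | uv , _ | no u∉X | yes v∈X =
      inj₂ (∧-intro uv (from (T-∨ {X u ∧ ∁ X v}) (inj₂ (∧-intro (from T-not u∉X) v∈X))))
    ... | uv , ¬extended | no u∉X | no v∉X =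
      inj₁ (∧-intro (from T-not u∉X) (∧-intro (from T-not v∉X) (∧-intro uv
        (from T-not λ suv → to T-not ¬extended (from (T-∨ {X u ∧ X v ∧ adj G u v}) (inj₂ suv))))))

  weak-sym : ∀ {S s} → (∀ u v → s u v ≡ s v u) → ∀ u v → weak S s u v ≡ weak S s v u
  weak-sym {S} {s} s-sym u v =
    trans (cong₂ (λ a b → S u ∧ (S v ∧ (a ∧ not b))) (sym G u v) (s-sym u v))
          (∧-swapˡ (S u) (S v) (adj G v u ∧ not (s v u)))

i+j≤k⇒i≤k-j : ∀ {i j k : ℤ} → i ℤ.+ j ℤ.≤ k → i ℤ.≤ k - j
i+j≤k⇒i≤k-j {i} {j} i+j≤k =
  ℤ.≤-trans (ℤ.≤-reflexive (≡.sym (//-rightDividesʳ j i))) (ℤ.+-monoˡ-≤ (- j) i+j≤k)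

i≤k-j⇒i+j≤k : ∀ {i j k : ℤ} → i ℤ.≤ k - j → i ℤ.+ j ℤ.≤ k
i≤k-j⇒i+j≤k {j = j} {k} i≤k-j =
  ℤ.≤-trans (ℤ.+-monoˡ-≤ j i≤k-j) (ℤ.≤-reflexive (//-rightDividesˡ j k))

module Reduction {n} (G : Graph n) (K NK N2K : VSet n)
  (K-critical : CriticalClique G K)
  (NK⇔𝒩 : ∀ v → (v ∈ NK) ⇔ In𝒩 G K v)
  (N2K⇔𝒩² : ∀ v → (v ∈ N2K) ⇔ In𝒩² G K v)
  (NK-clique : IsClique G NK) where

  removed : VSet n
  removed v = K v ∨ NK v

  K⊆removed : ∀ v → v ∈ K → v ∉ ∁ removed
  K⊆removed v v∈K v∈kept = to T-not v∈kept (from T-∨ (inj₁ v∈K))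

  NK⊆removed : ∀ v → v ∈ NK → v ∉ ∁ removed
  NK⊆removed v v∈NK v∈kept = to T-not v∈kept (from (T-∨ {K v}) (inj₂ v∈NK))

  e : ℕ
  e = edgesBetween G NK N2K

  CAdj⇒∈NK : ∀ {K′ v} → CriticalClique G K′ → CAdj G K K′ → v ∈ K′ → v ∈ NK
  CAdj⇒∈NK {K′} {v} K′-critical K~K′ v∈K′ = from (NK⇔𝒩 v) (K′ , K′-critical , K~K′ , v∈K′)

  K-NK-adjacent : ∀ u v → u ∈ K → v ∈ NK → T (adj G u v)
  K-NK-adjacent u v u∈K v∈NK with to (NK⇔𝒩 v) v∈NK
  ... | _ , _ , K~K′ , v∈K′ = K~K′ u v u∈K v∈K′

  K∩NK=∅ : Disjoint K NK
  K∩NK=∅ v v∈K v∈NK = subst T (irrefl G v) (K-NK-adjacent v v v∈K v∈NK)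

  removed-clique : IsClique G removed
  removed-clique u w u∈ w∈ u≢w with to (T-∨ {K u}) u∈ | to (T-∨ {K w}) w∈
  ... | inj₁ u∈K | inj₁ w∈K = proj₁ (proj₁ K-critical) u w u∈K w∈K u≢w
  ... | inj₁ u∈K | inj₂ w∈NK = K-NK-adjacent u w u∈K w∈NK
  ... | inj₂ u∈NK | inj₁ w∈K = subst T (sym G w u) (K-NK-adjacent w u w∈K u∈NK)
  ... | inj₂ u∈NK | inj₂ w∈NK = NK-clique u w u∈NK w∈NK u≢w

  -- The critical clique C of w is adjacent in 𝒞 to every critical clique containing u and not w;
  -- this rules out u ∈ K and makes C a neighbour of the critical clique of u ∈ 𝒩(K).
  removed-kept-edge : ∀ u w → u ∈ removed → w ∈ ∁ removed → T (adj G u w) → u ∈ NK × w ∈ N2K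
  removed-kept-edge u w u∈ w∈kept uw = u∈NK , w∈N2K
    where
    C : VSet n
    C = twins G w
    C-critical : CriticalClique G C
    C-critical = twins-critical G w
    w∈C : w ∈ C
    w∈C = twins-refl G w
    w∉K : w ∉ K
    w∉K w∈K = K⊆removed w w∈K w∈kept
    w∉NK : w ∉ NK
    w∉NK w∈NK = NK⊆removed w w∈NK w∈kept
    CAdj-C : ∀ {K′} → CriticalClique G K′ → w ∉ K′ → u ∈ K′ → CAdj G K′ C
    CAdj-C {K′} K′-critical w∉K′ u∈K′ =
      sameNbhdCliques-CAdj G (proj₁ K′-critical) (proj₁ C-critical) K′∩C=∅ u∈K′ w∈C uw
      where
      K′∩C=∅ : Disjoint K′ C
      K′∩C=∅ x x∈K′ x∈C =
        w∉K′ (subst T (≡.sym (critical-≐ G K′-critical C-critical x∈K′ x∈C w)) w∈C)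
    u∈NK : u ∈ NK
    u∈NK with to (T-∨ {K u}) u∈
    ... | inj₁ u∈K = ⊥-elim (w∉NK (CAdj⇒∈NK C-critical (CAdj-C K-critical w∉K u∈K) w∈C))
    ... | inj₂ u∈NK = u∈NK
    w∈N2K : w ∈ N2K
    w∈N2K with to (NK⇔𝒩 u) u∈NK
    ... | K′ , K′-critical , K~K′ , u∈K′ = from (N2K⇔𝒩² w)
      ( C , C-critical , w∈C
      , (λ K≐C → w∉K (subst T (≡.sym (K≐C w)) w∈C))
      , (λ K~C → w∉NK (CAdj⇒∈NK C-critical K~C w∈C))
      , K′ , K′-critical , K~K′ , CAdj-C K′-critical (w∉NK ∘ CAdj⇒∈NK K′-critical K~K′) u∈K′ )

  edgesBetween-removed-kept-≤ : edgesBetween G removed (∁ removed) ≤ e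
  edgesBetween-removed-kept-≤ = countPairs-mono-≤ _ _ boundary
    where
    boundary : ∀ u v → T (adj G u v ∧ crossing removed (∁ removed) u v) →
      T (adj G u v ∧ crossing NK N2K u v)
    boundary u v t with to (T-∧ {adj G u v}) t
    ... | uv , c = ∧-intro uv (crossing⁺ NK N2K u v (Sum.map
      (λ (u∈ , v∈kept) → removed-kept-edge u v u∈ v∈kept uv)
      (λ (u∈kept , v∈) → swap (removed-kept-edge v u v∈ u∈kept (subst T (sym G u v) uv)))
      (crossing⁻ removed (∁ removed) u v c)))

  K-N2K-distant : ∀ u w → u ∈ K → w ∈ N2K → u ≢ w × ¬ T (adj G u w)
  K-N2K-distant u w u∈K w∈N2K with to (N2K⇔𝒩² w) w∈N2K
  ... | K″ , K″-critical , w∈K″ , K≉K″ , ¬K~K″ , _ =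
    (λ { refl → K∩K″=∅ u u∈K w∈K″ }) ,
    (λ uw → ¬K~K″ (sameNbhdCliques-CAdj G (proj₁ K-critical) (proj₁ K″-critical)
                                        K∩K″=∅ u∈K w∈K″ uw))
    where
    K∩K″=∅ : Disjoint K K″
    K∩K″=∅ x x∈K x∈K″ = K≉K″ (critical-≐ G K-critical K″-critical x∈K x∈K″)

  NK-N2K-weak⇒weak-restrict-+-e-≤ : ∀ {s} → IsSTCLabeling G allV s →
    (∀ v w → v ∈ NK → w ∈ N2K → ¬ T (s v w)) →
    countPairs (weak G (∁ removed) (restrict G (∁ removed) s)) + e ≤ countPairs (weak G allV s)
  NK-N2K-weak⇒weak-restrict-+-e-≤ {s} (s-sym , _) NK-N2K-weak =
    weak-restrict-+-≤ G (∁ removed) s _ crossing-weak crossing-leaves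
    where
    weak-NK-N2K : ∀ v w → v ∈ NK → w ∈ N2K → T (adj G v w) → T (weak G allV s v w)
    weak-NK-N2K v w v∈NK w∈N2K vw = ∧-intro vw (from T-not (NK-N2K-weak v w v∈NK w∈N2K))
    crossing-weak : ∀ u v → T (adj G u v ∧ crossing NK N2K u v) → T (weak G allV s u v)
    crossing-weak u v t with to (T-∧ {adj G u v}) t
    ... | uv , c with crossing⁻ NK N2K u v c
    ... | inj₁ (u∈NK , v∈N2K) = weak-NK-N2K u v u∈NK v∈N2K uv
    ... | inj₂ (u∈N2K , v∈NK) =
      subst T (weak-sym G {allV} s-sym v u) (weak-NK-N2K v u v∈NK u∈N2K (subst T (sym G u v) uv))
    crossing-leaves : ∀ u v → T (adj G u v ∧ crossing NK N2K u v) → u ∉ ∁ removed ⊎ v ∉ ∁ removed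
    crossing-leaves u v t with crossing⁻ NK N2K u v (proj₂ (to (T-∧ {adj G u v}) t))
    ... | inj₁ (u∈NK , _) = inj₁ (NK⊆removed u u∈NK)
    ... | inj₂ (_ , v∈NK) = inj₂ (NK⊆removed v v∈NK)

  NK-N2K-strong⇒weak-restrict-+-∣K∣-≤ : ∀ {s} → IsSTCLabeling G allV s →
    ∀ v w → v ∈ NK → w ∈ N2K → T (s v w) →
    countPairs (weak G (∁ removed) (restrict G (∁ removed) s)) + ∣ K ∣ ≤ countPairs (weak G allV s)
  NK-N2K-strong⇒weak-restrict-+-∣K∣-≤ {s} (s-sym , _ , s-closed) v w v∈NK w∈N2K svw = ≤-trans
    (+-monoʳ-≤ _ (∣∣≤countPairs-crossing-｛｝ K v (λ v∈K → K∩NK=∅ v v∈K v∈NK)))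
    (weak-restrict-+-≤ G (∁ removed) s _ star-weak star-leaves)
    where
    weak-K-v : ∀ u → u ∈ K → T (weak G allV s u v)
    weak-K-v u u∈K with K-N2K-distant u w u∈K w∈N2K
    ... | u≢w , ¬uw =
      ∧-intro (K-NK-adjacent u v u∈K v∈NK) (from T-not λ suv → ¬uw (s-closed u v w u≢w suv svw))
    star-weak : ∀ i j → T (crossing K ｛ v ｝ i j) → T (weak G allV s i j)
    star-weak i j t with crossing⁻ K ｛ v ｝ i j t
    ... | inj₁ (i∈K , j≡v) rewrite to (T-does (j ≟ v)) j≡v = weak-K-v i i∈K
    ... | inj₂ (i≡v , j∈K) rewrite to (T-does (i ≟ v)) i≡v =
      subst T (weak-sym G {allV} s-sym j v) (weak-K-v j j∈K)
    star-leaves : ∀ i j → T (crossing K ｛ v ｝ i j) → i ∉ ∁ removed ⊎ j ∉ ∁ removed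
    star-leaves i j t with crossing⁻ K ｛ v ｝ i j t
    ... | inj₁ (i∈K , _) = inj₁ (K⊆removed i i∈K)
    ... | inj₂ (_ , j∈K) = inj₂ (K⊆removed j j∈K)

  weak-restrict-+-e-≤ : ∣ K ∣ > e → ∀ {s} → IsSTCLabeling G allV s →
    countPairs (weak G (∁ removed) (restrict G (∁ removed) s)) + e ≤ countPairs (weak G allV s)
  weak-restrict-+-e-≤ K-large {s} s-STC
    with any? (λ v → any? (λ w → T? (NK v) ×-dec T? (N2K w) ×-dec T? (s v w)))
  ... | yes (v , w , v∈NK , w∈N2K , svw) =
    ≤-trans (+-monoʳ-≤ _ (<⇒≤ K-large))
            (NK-N2K-strong⇒weak-restrict-+-∣K∣-≤ s-STC v w v∈NK w∈N2K svw)
  ... | no no-strong = NK-N2K-weak⇒weak-restrict-+-e-≤ s-STC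
    λ v w v∈NK w∈N2K svw → no-strong (v , w , v∈NK , w∈N2K , svw)

  forward : ∀ {k} → ∣ K ∣ > e → STCSolvable G allV (+ k) → STCSolvable G (∁ removed) (+ k - + e)
  forward {k} K-large (s , s-sym , s-edges , s-closed , budget) =
    STCSolvable⁺ G (restrict G (∁ removed) s) (restrict-isSTC G s-STC) (i+j≤k⇒i≤k-j {+ w} {+ e} (begin
      + w ℤ.+ + e                        ≡⟨ pos-+ w e ⟨
      + (w + e)                          ≤⟨ +≤+ (weak-restrict-+-e-≤ K-large s-STC) ⟩
      + countPairs (weak G allV s)       ≤⟨ budget ⟩
      + k                                ∎))
    where
    open ℤ.≤-Reasoning
    s-STC : IsSTCLabeling G allV s
    s-STC = s-sym , s-edges , s-closed
    w : ℕ
    w = countPairs (weak G (∁ removed) (restrict G (∁ removed) s))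

  backward : ∀ {k} → STCSolvable G (∁ removed) (+ k - + e) → STCSolvable G allV (+ k)
  backward {k} (s , s-sym , s-edges , s-closed , budget) =
    STCSolvable⁺ G (extend G removed s) (extend-isSTC G removed-clique (s-sym , s-edges , s-closed)) (begin
      + countPairs (weak G allV (extend G removed s))
        ≤⟨ +≤+ (≤-trans (weak-extend-≤ G removed s) (+-monoʳ-≤ w edgesBetween-removed-kept-≤)) ⟩
      + (w + e)     ≡⟨ pos-+ w e ⟩
      + w ℤ.+ + e   ≤⟨ i≤k-j⇒i+j≤k {j = + e} budget ⟩
      + k           ∎)
    where
    open ℤ.≤-Reasoning
    w : ℕ
    w = countPairs (weak G (∁ removed) s)

proposition4 : ∀ {n} (G : Graph n) (k : ℕ) (K NK N2K : VSet n)
    → CriticalClique G K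
    → (∀ v → (v ∈ NK) ⇔ In𝒩 G K v)
    → (∀ v → (v ∈ N2K) ⇔ In𝒩² G K v)
    → IsClique G NK
    → ∣ K ∣ > edgesBetween G NK N2K
    → STCSolvable G allV (+ k)
      ⇔ STCSolvable G (λ v → not (K v ∨ NK v)) (+ k - + edgesBetween G NK N2K)
proposition4 G k K NK N2K K-critical NK⇔𝒩 N2K⇔𝒩² NK-clique K-large = mk⇔ (forward K-large) backward
  where open Reduction G K NK N2K K-critical NK⇔𝒩 N2K⇔𝒩² NK-clique
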